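{- Let $I=(n,m,X_1,\ldots,X_m,\tau)$ be a YES-instance of WPPSG. Then every valid elementary transformation of $I$ is a YES-instance of WPPSG; that is, for every $j'\in\{0,1,\ldots,m\}$ and every $\varphi\in\mathcal{S}_{X_{j'}}$ (with $X_0=[n]$), $I[j',\varphi]$ is a YES-instance.
   Context: $\mathcal{S}_n$ is the symmetric group on $[n]=\{1,\ldots,n\}$, with $i\sigma$ the image of $i$ and products composed left to right; $X\sigma=\{i\sigma:i\in X\}$; $\mathcal{S}_X$ is the subgroup fixing every element outside $X$. An instance $(n,m,X_1,\ldots,X_m,\tau)$ of WPPSG ($X_j\subseteq[n]$, $\tau\in\mathcal{S}_n$) is a YES-instance iff $\tau=\sigma_1\cdots\sigma_m$ for some $\sigma_j\in\mathcal{S}_{X_j}$. For $\pi\in\mathcal{S}_n$, $I^\pi=(n,m,X_1\pi,\ldots,X_m\pi,\pi^{ -1}\tau\pi)$. For $j'\in[m]$ and $\varphi\in\mathcal{S}_{X_{j'}}$, $I[j',\varphi]=(n,m,X'_1,\ldots,X'_m,\tau\varphi)$ where $X'_j=X_j$ for $j\le j'$ and $X'_j=X_j\varphi$ for $j>j'$; also $X_0=[n]$ and $I[0,\varphi]=I^\varphi$. A valid elementary transformation of $I$ is any $I[j,\varphi]$ with $j\in\{0,\ldots,m\}$ and $\varphi\in\mathcal{S}_{X_j}$. -}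

module Defs where

open import Data.Nat using (ℕ; zero; suc)
open import Data.Fin using (Fin; zero; suc; _≤_)
open import Data.Fin.Subset using (Subset; _∈_; _∉_; ⊤)
open import Data.Fin.Permutation using (Permutation′; _⟨$⟩ʳ_; _⟨$⟩ˡ_; _∘ₚ_; id; flip; _≈_)
open import Data.Vec using (tabulate; lookup)
open import Data.Product using (Σ; _×_)
open import Data.Bool using (if_then_else_)
open import Relation.Binary.PropositionalEquality using (_≡_)
open import Relation.Nullary using (does)
open import Data.Fin.Properties using (_≤?_)

-- S_n : permutations of [n] = Fin n.  Composition is left to right:
-- i (σ ∘ₚ ρ) = (i σ) ρ, matching the paper's convention.
Perm : ℕ → Set
Perm n = Permutation′ n

InSym : ∀ {n} → Subset n → Perm n → Set
InSym {n} X σ = ∀ (i : Fin n) → i ∉ X → σ ⟨$⟩ʳ i ≡ i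

-- image X σ = { i σ : i ∈ X } ; k ∈ Xσ iff k σ⁻¹ ∈ X
image : ∀ {n} → Subset n → Perm n → Subset n
image X σ = tabulate (λ k → lookup X (σ ⟨$⟩ˡ k))

record Instance : Set where
  constructor inst
  field
    n : ℕ
    m : ℕ
    X : Fin m → Subset n
    τ : Perm n

prod : ∀ {n m} → (Fin m → Perm n) → Perm n
prod {m = zero}  σ = id
prod {m = suc m} σ = σ zero ∘ₚ prod (λ j → σ (suc j))

YES : Instance → Set
YES (inst n m X τ) =
  Σ (Fin m → Perm n) (λ σ → (∀ j → InSym (X j) (σ j)) × (τ ≈ prod σ))

-- X_0 = [n], X_j for j ∈ [m]; index j' ∈ {0..m} is Fin (suc m)
Xext : (I : Instance) → Fin (suc (Instance.m I)) → Subset (Instance.n I)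
Xext I zero    = ⊤
Xext I (suc j) = Instance.X I j

conj : (I : Instance) → Perm (Instance.n I) → Instance
conj (inst n m X τ) π = inst n m (λ j → image (X j) π) ((flip π ∘ₚ τ) ∘ₚ π)

-- I[j', φ] for j' ∈ [m] (given as j : Fin m, j' = j+1):
-- X'_k = X_k for k ≤ j' , X'_k = X_k φ for k > j', and τ' = τ φ.
shift : (I : Instance) → Fin (Instance.m I) → Perm (Instance.n I) → Instance
shift (inst n m X τ) j φ =
  inst n m (λ k → if does (k ≤? j) then X k else image (X k) φ) (τ ∘ₚ φ)

elem : (I : Instance) → Fin (suc (Instance.m I)) → Perm (Instance.n I) → Instance
elem I zero    φ = conj I φ
elem I (suc j) φ = shift I j φ

-- The factorisation of τ is transported factor by factor.  For j' = 0,
-- conjugating every σ_k by φ gives φ⁻¹τφ = ∏ φ⁻¹σ_kφ with φ⁻¹σ_kφ ∈ S_{X_kφ}.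
-- For j' ≥ 1, τφ = σ_1 ⋯ σ_{j'-1} (σ_{j'}φ) (φ⁻¹σ_{j'+1}φ) ⋯ (φ⁻¹σ_mφ),
-- since the inserted φ φ⁻¹ cancel, and σ_{j'}φ ∈ S_{X_{j'}} because φ ∈ S_{X_{j'}}.
module Submission where

open import Defs
open import Data.Nat using (ℕ; zero; suc; z≤n; s≤s)
open import Data.Fin using (Fin; zero; suc; _≤_)
open import Data.Fin.Properties using (_≤?_)
open import Data.Fin.Subset using (Subset; _∉_)
open import Data.Fin.Permutation using (_⟨$⟩ʳ_; _⟨$⟩ˡ_; _∘ₚ_; flip; _≈_; inverseʳ; inverseˡ)
open import Data.Vec using (lookup)
open import Data.Vec.Properties using (lookup∘tabulate; []=⇒lookup; lookup⇒[]=)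
open import Data.Product using (_,_)
open import Data.Bool using (if_then_else_)
open import Data.Empty using (⊥-elim)
open import Function using (_∘_)
open import Relation.Nullary using (¬_; Dec; does; yes; no)
open import Relation.Binary.PropositionalEquality using (sym; trans; cong; module ≡-Reasoning)

private
  variable
    n m : ℕ

conjugate : Perm n → Perm n → Perm n
conjugate π σ = flip π ∘ₚ σ ∘ₚ π

∉-image⇒⟨$⟩ˡ∉ : ∀ (X : Subset n) (π : Perm n) {i} → i ∉ image X π → π ⟨$⟩ˡ i ∉ X
∉-image⇒⟨$⟩ˡ∉ X π {i} i∉Xπ πˡi∈X = i∉Xπ (lookup⇒[]= i (image X π)
  (trans (lookup∘tabulate (λ k → lookup X (π ⟨$⟩ˡ k)) i) ([]=⇒lookup πˡi∈X)))

InSym-conjugate : ∀ (X : Subset n) σ π → InSym X σ → InSym (image X π) (conjugate π σ)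
InSym-conjugate X σ π σ∈S i i∉Xπ = begin
  π ⟨$⟩ʳ (σ ⟨$⟩ʳ (π ⟨$⟩ˡ i))  ≡⟨ cong (π ⟨$⟩ʳ_) (σ∈S _ (∉-image⇒⟨$⟩ˡ∉ X π i∉Xπ)) ⟩
  π ⟨$⟩ʳ (π ⟨$⟩ˡ i)            ≡⟨ inverseʳ π ⟩
  i                            ∎
  where open ≡-Reasoning

InSym-∘ₚ : ∀ (X : Subset n) σ ρ → InSym X σ → InSym X ρ → InSym X (σ ∘ₚ ρ)
InSym-∘ₚ X σ ρ σ∈S ρ∈S i i∉X = trans (cong (ρ ⟨$⟩ʳ_) (σ∈S i i∉X)) (ρ∈S i i∉X)

prod-conjugate : ∀ (π : Perm n) (σ : Fin m → Perm n) →
                 prod (conjugate π ∘ σ) ≈ conjugate π (prod σ)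
prod-conjugate         {m = zero}  π σ i = sym (inverseʳ π)
prod-conjugate {n = n} {m = suc m} π σ i = begin
  prod (conjugate π ∘ σ ∘ suc) ⟨$⟩ʳ (conjugate π (σ zero) ⟨$⟩ʳ i)
    ≡⟨ prod-conjugate π (σ ∘ suc) _ ⟩
  π ⟨$⟩ʳ (rest ⟨$⟩ʳ (π ⟨$⟩ˡ (π ⟨$⟩ʳ (σ zero ⟨$⟩ʳ (π ⟨$⟩ˡ i)))))
    ≡⟨ cong (λ k → π ⟨$⟩ʳ (rest ⟨$⟩ʳ k)) (inverseˡ π) ⟩
  π ⟨$⟩ʳ (rest ⟨$⟩ʳ (σ zero ⟨$⟩ʳ (π ⟨$⟩ˡ i)))
    ∎
  where
  open ≡-Reasoning
  rest : Perm n
  rest = prod (σ ∘ suc)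

-- j is 0-based: these are the factors of τφ for I[j+1, φ].
shiftFactors : Fin m → Perm n → (Fin m → Perm n) → Fin m → Perm n
shiftFactors zero    φ σ zero    = σ zero ∘ₚ φ
shiftFactors zero    φ σ (suc k) = conjugate φ (σ (suc k))
shiftFactors (suc j) φ σ zero    = σ zero
shiftFactors (suc j) φ σ (suc k) = shiftFactors j φ (σ ∘ suc) k

prod-shiftFactors : ∀ (j : Fin m) (φ : Perm n) (σ : Fin m → Perm n) →
                    prod (shiftFactors j φ σ) ≈ prod σ ∘ₚ φ
prod-shiftFactors {n = n} zero φ σ i = begin
  prod (conjugate φ ∘ σ ∘ suc) ⟨$⟩ʳ (φ ⟨$⟩ʳ (σ zero ⟨$⟩ʳ i))
    ≡⟨ prod-conjugate φ (σ ∘ suc) _ ⟩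
  φ ⟨$⟩ʳ (rest ⟨$⟩ʳ (φ ⟨$⟩ˡ (φ ⟨$⟩ʳ (σ zero ⟨$⟩ʳ i))))
    ≡⟨ cong (λ k → φ ⟨$⟩ʳ (rest ⟨$⟩ʳ k)) (inverseˡ φ) ⟩
  φ ⟨$⟩ʳ (rest ⟨$⟩ʳ (σ zero ⟨$⟩ʳ i))
    ∎
  where
  open ≡-Reasoning
  rest : Perm n
  rest = prod (σ ∘ suc)
prod-shiftFactors          (suc j) φ σ i = prod-shiftFactors j φ (σ ∘ suc) (σ zero ⟨$⟩ʳ i)

InSym-shiftFactors-≤ : ∀ (X : Fin m → Subset n) σ φ (j k : Fin m) →
                       (∀ k → InSym (X k) (σ k)) → InSym (X j) φ → k ≤ j →
                       InSym (X k) (shiftFactors j φ σ k)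
InSym-shiftFactors-≤ X σ φ zero    zero    σ∈S φ∈S _ =
  InSym-∘ₚ (X zero) (σ zero) φ (σ∈S zero) φ∈S
InSym-shiftFactors-≤ X σ φ (suc j) zero    σ∈S _   _ = σ∈S zero
InSym-shiftFactors-≤ X σ φ (suc j) (suc k) σ∈S φ∈S (s≤s k≤j) =
  InSym-shiftFactors-≤ (X ∘ suc) (σ ∘ suc) φ j k (σ∈S ∘ suc) φ∈S k≤j

InSym-shiftFactors-> : ∀ (X : Fin m → Subset n) σ φ (j k : Fin m) →
                       (∀ k → InSym (X k) (σ k)) → ¬ k ≤ j →
                       InSym (image (X k) φ) (shiftFactors j φ σ k)
InSym-shiftFactors-> X σ φ zero    zero    _   k≰j = ⊥-elim (k≰j z≤n)
InSym-shiftFactors-> X σ φ zero    (suc k) σ∈S _   =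
  InSym-conjugate (X (suc k)) (σ (suc k)) φ (σ∈S (suc k))
InSym-shiftFactors-> X σ φ (suc j) zero    _   k≰j = ⊥-elim (k≰j z≤n)
InSym-shiftFactors-> X σ φ (suc j) (suc k) σ∈S k≰j =
  InSym-shiftFactors-> (X ∘ suc) (σ ∘ suc) φ j k (σ∈S ∘ suc) (k≰j ∘ s≤s)

InSym-if : ∀ {P : Set} (P? : Dec P) (A B : Subset n) σ →
           (P → InSym A σ) → (¬ P → InSym B σ) →
           InSym (if does P? then A else B) σ
InSym-if (yes p)  _ _ _ σ∈SA _    = σ∈SA p
InSym-if (no  ¬p) _ _ _ _    σ∈SB = σ∈SB ¬p

lemma5p1 : (I : Instance) → YES I →
    (j' : Fin (suc (Instance.m I))) (φ : Perm (Instance.n I)) →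
    InSym (Xext I j') φ → YES (elem I j' φ)
lemma5p1 (inst n m X τ) (σ , σ∈S , τ≈∏σ) zero φ _ =
  (λ k → conjugate φ (σ k)) ,
  (λ k → InSym-conjugate (X k) (σ k) φ (σ∈S k)) ,
  λ i → trans (cong (φ ⟨$⟩ʳ_) (τ≈∏σ (φ ⟨$⟩ˡ i))) (sym (prod-conjugate φ σ i))
lemma5p1 (inst n m X τ) (σ , σ∈S , τ≈∏σ) (suc j) φ φ∈S =
  shiftFactors j φ σ ,
  factor∈S ,
  λ i → trans (cong (φ ⟨$⟩ʳ_) (τ≈∏σ i)) (sym (prod-shiftFactors j φ σ i))
  where
  factor∈S : ∀ k → InSym (if does (k ≤? j) then X k else image (X k) φ)
                         (shiftFactors j φ σ k)
  factor∈S k = InSym-if (k ≤? j) (X k) (image (X k) φ) (shiftFactors j φ σ k)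
    (InSym-shiftFactors-≤ X σ φ j k σ∈S φ∈S)
    (InSym-shiftFactors-> X σ φ j k σ∈S)
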